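{- Let $\delta>0$ and let $G$ be an abelian group of order $2n$. Then $G$ has at most $2/\delta$ subgroups of index $2$ that are not nice.
   Context: For $X\subset G$, $r(X)$ is the number of $x\in X$ with $x=-x$. An index-$2$ subgroup $\mathcal{E}$ of $G$, with $\mathcal{O}=G\setminus\mathcal{E}$, is nice if either $r(G)\leqslant\delta n$ or $r(\mathcal{O})=r(\mathcal{E})$.
   Formalization: The parameter δ ranges over the positive rationals. -}

module Defs where

open import Data.Nat using (ℕ; _*_)
open import Data.Fin using (Fin; _≟_)
open import Data.Fin.Subset using (Subset; _∈_; ∣_∣; _∩_; ∁)
open import Data.Vec using (tabulate)
open import Data.Product using (_×_)
open import Data.Sum using (_⊎_)
open import Data.Integer using (+_)
open import Data.Rational as ℚ using (ℚ; _/_)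
open import Relation.Nullary using (does)
open import Relation.Binary.PropositionalEquality using (_≡_)
open import Algebra.Structures using (IsAbelianGroup)
open import Algebra.Core using (Op₁; Op₂)

-- A finite abelian group of order m is modelled (up to isomorphism) as an
-- abelian group structure on the carrier Fin m, with equality _≡_.
record FinAbGroup (m : ℕ) : Set where
  field
    _+_ : Op₂ (Fin m)
    0g  : Fin m
    -_  : Op₁ (Fin m)
    isAbelianGroup : IsAbelianGroup _≡_ _+_ 0g -_

ℕ→ℚ : ℕ → ℚ
ℕ→ℚ k = (+ k) / 1

module _ {m : ℕ} (G : FinAbGroup m) where
  open FinAbGroup G

  selfInv : Subset m
  selfInv = tabulate (λ x → does (x ≟ (- x)))

  r : Subset m → ℕ
  r X = ∣ X ∩ selfInv ∣

  IsSubgroup : Subset m → Set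
  IsSubgroup E = (0g ∈ E)
               × (∀ x y → x ∈ E → y ∈ E → (x + y) ∈ E)
               × (∀ x → x ∈ E → (- x) ∈ E)

  IsIndex2Subgroup : Subset m → Set
  IsIndex2Subgroup E = IsSubgroup E × (m ≡ 2 * ∣ E ∣)

Nice : (n : ℕ) → FinAbGroup (2 * n) → ℚ → Subset (2 * n) → Set
Nice n G δ E =
  (ℕ→ℚ (r G (tabulate (λ _ → Data.Bool.true))) ℚ.≤ δ ℚ.* ℕ→ℚ n)
  ⊎ (r G (∁ E) ≡ r G E)
  where import Data.Bool

module Submission where

-- An index-2 subgroup E gives a character χ_E : G → {±1} (+1 on E, −1 off E),
-- and distinct index-2 subgroups give orthogonal characters: Σ_x χ_E χ_F = 0.
-- Hence for L distinct index-2 subgroups E₁,…,E_L and g = Σᵢ χ_{Eᵢ} we get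
-- Σ_x g(x)² = L·|G|.  If E is not nice then r(O) ≠ r(E), and translating by a
-- self-inverse element outside E would swap E and O while preserving the
-- self-inverse elements; so every self-inverse element lies in E.  On the
-- r(G) self-inverse elements g therefore equals L, giving L²·r(G) ≤ L·|G|,
-- i.e. L·r(G) ≤ 2n.  Non-niceness also gives r(G) > δn, whence L·δ < 2.

open import Defs
open import Data.Bool using (Bool; true; false; not; _∧_)
import Data.Bool as Bool
open import Data.Bool.Properties using (not-involutive)
open import Data.Empty using (⊥-elim)
open import Data.Fin using (Fin; _≟_)
import Data.Fin as Fin
open import Data.Fin.Properties using (¬∀⟶∃¬)
open import Data.Fin.Permutation using (permutation)
open import Data.Fin.Subset using (Subset; ∣_∣; _∩_; ∁)
open import Data.Integer as ℤ using (ℤ; +_; 0ℤ; 1ℤ; -1ℤ; -[1+_]; +≤+)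
import Data.Integer.Properties as ℤP
open import Data.Integer.Solver using (module +-*-Solver)
open import Data.List using (List; []; _∷_; length)
open import Data.List.Relation.Unary.All as All using (All; []; _∷_)
open import Data.List.Relation.Unary.AllPairs using ([]; _∷_)
open import Data.List.Relation.Unary.Unique.Propositional using (Unique)
open import Data.Nat as ℕ using (ℕ; zero; suc; _*_; z≤n)
import Data.Nat.Coprimality as Coprime
import Data.Nat.Properties as ℕP
open import Data.Product using (_×_; _,_; proj₁; proj₂; ∃)
open import Data.Rational as ℚ using (ℚ; 0ℚ; _/_)
import Data.Rational.Properties as ℚP
open import Data.Sum using (inj₁; inj₂)
open import Data.Vec using (lookup; tabulate)
import Data.Vec.Properties as VecP
open import Function using (_∘_)
open import Level using (0ℓ)
open import Algebra.Bundles using (Group)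
import Algebra.Properties.Group as GroupProperties
open import Algebra.Structures using (IsAbelianGroup)
open import Algebra.Properties.Semiring.Sum ℤP.+-*-semiring
  using (sum; sum-cong-≗; ∑-distrib-+; sum-permute; *-distribˡ-sum; sum-replicate-zero)
open import Relation.Binary.PropositionalEquality
open import Relation.Nullary using (¬_; Dec; yes; no; does)
open import Relation.Nullary.Decidable using (does-⇔)
open import Function.Bundles using (mk⇔)
open import Algebra.Properties.CommutativeSemigroup ℤP.*-commutativeSemigroup using (interchange)

ind : Bool → ℤ
ind true  = 1ℤ
ind false = 0ℤ

sgn : Bool → ℤ
sgn true  = 1ℤ
sgn false = -1ℤ

sgn-not : ∀ b → sgn (not b) ≡ sgn b ℤ.* -1ℤ
sgn-not true  = refl
sgn-not false = refl

sgn-square : ∀ b → sgn b ℤ.* sgn b ≡ 1ℤ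
sgn-square true  = refl
sgn-square false = refl

sgn-differ : ∀ {b c} → b ≢ c → sgn b ℤ.* sgn c ≡ -1ℤ
sgn-differ {true}  {false} _ = refl
sgn-differ {false} {true}  _ = refl
sgn-differ {true}  {true}  b≢c = ⊥-elim (b≢c refl)
sgn-differ {false} {false} b≢c = ⊥-elim (b≢c refl)

ind-complementary : ∀ b c → ind b ℤ.+ ind c ≡ 1ℤ → b ≡ not c
ind-complementary true  false _ = refl
ind-complementary false true  _ = refl
ind-complementary true  true  ()
ind-complementary false false ()

bool-ext : ∀ {b c} → (b ≡ true → c ≡ true) → (c ≡ true → b ≡ true) → b ≡ c
bool-ext {true}  {c}     b⇒c _   = sym (b⇒c refl)
bool-ext {false} {true}  _   c⇒b = c⇒b refl
bool-ext {false} {false} _   _   = refl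

does-true : ∀ {P : Set} (d : Dec P) → does d ≡ true → P
does-true (yes p) _ = p

distinct⇒differ : ∀ {m} (E F : Subset m) → E ≢ F → ∃ λ a → lookup E a ≢ lookup F a
distinct⇒differ E F E≢F =
  ¬∀⟶∃¬ _ (λ a → lookup E a ≡ lookup F a) (λ a → lookup E a Bool.≟ lookup F a) pointwise≢
  where
  pointwise≢ : ¬ (∀ a → lookup E a ≡ lookup F a)
  pointwise≢ same = E≢F (trans (sym (VecP.tabulate∘lookup E))
                          (trans (VecP.tabulate-cong same) (VecP.tabulate∘lookup F)))

card-sum : ∀ {m} (A : Subset m) → + ∣ A ∣ ≡ sum (ind ∘ lookup A)
card-sum Data.Vec.[]            = refl
card-sum (true  Data.Vec.∷ A) = cong (λ s → 1ℤ ℤ.+ s) (card-sum A)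
card-sum (false Data.Vec.∷ A) = trans (card-sum A) (sym (ℤP.+-identityˡ _))

sum-const-one : ∀ m → sum {m} (λ _ → 1ℤ) ≡ + m
sum-const-one zero    = refl
sum-const-one (suc m) = cong (λ s → 1ℤ ℤ.+ s) (sum-const-one m)

sum-mono : ∀ {m} {f g : Fin m → ℤ} → (∀ x → f x ℤ.≤ g x) → sum f ℤ.≤ sum g
sum-mono {zero}  f≤g = ℤP.≤-refl
sum-mono {suc m} f≤g = ℤP.+-mono-≤ (f≤g Fin.zero) (sum-mono (f≤g ∘ Fin.suc))

sum-strict : ∀ {m} {f g : Fin m → ℤ} → (∀ x → f x ℤ.≤ g x) →
             ∀ x → f x ℤ.< g x → sum f ℤ.< sum g
sum-strict f≤g Fin.zero    fx<gx = ℤP.+-mono-<-≤ fx<gx (sum-mono (f≤g ∘ Fin.suc))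
sum-strict f≤g (Fin.suc x) fx<gx = ℤP.+-mono-≤-< (f≤g Fin.zero) (sum-strict (f≤g ∘ Fin.suc) x fx<gx)

sum-tight : ∀ {m} {f g : Fin m → ℤ} → (∀ x → f x ℤ.≤ g x) → sum f ≡ sum g → ∀ x → f x ≡ g x
sum-tight {f = f} {g} f≤g Σf≡Σg x with f x ℤP.≟ g x
... | yes fx≡gx = fx≡gx
... | no  fx≢gx = ⊥-elim (ℤP.<-irrefl Σf≡Σg (sum-strict f≤g x (ℤP.≤∧≢⇒< (f≤g x) fx≢gx)))

self-negating⇒zero : ∀ s → s ≡ -1ℤ ℤ.* s → s ≡ 0ℤ
self-negating⇒zero (+ zero)  _  = refl
self-negating⇒zero (+ suc k) ()
self-negating⇒zero -[1+ k ]  ()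

square-nonNeg : ∀ i → 0ℤ ℤ.≤ i ℤ.* i
square-nonNeg (+ k)    rewrite sym (ℤP.pos-* k k) = +≤+ z≤n
square-nonNeg -[1+ k ] = +≤+ z≤n

character : ∀ {m} → Subset m → Fin m → ℤ
character E x = sgn (lookup E x)

characterSum : ∀ {m} → List (Subset m) → Fin m → ℤ
characterSum []       x = 0ℤ
characterSum (E ∷ Es) x = character E x ℤ.+ characterSum Es x

-- (a + g)² expanded so that the cross terms a·g can be summed separately
square-expand : ∀ a g → (a ℤ.+ g) ℤ.* (a ℤ.+ g) ≡ (a ℤ.* a ℤ.+ g ℤ.* g) ℤ.+ (a ℤ.* g ℤ.+ a ℤ.* g)
square-expand = solve 2 (λ a g → (a :+ g) :* (a :+ g) := (a :* a :+ g :* g) :+ (a :* g :+ a :* g)) refl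
  where open +-*-Solver

module _ {m : ℕ} (G : FinAbGroup m) where
  open FinAbGroup G renaming (_+_ to _∙_; -_ to ⁻_)
  open IsAbelianGroup isAbelianGroup using (isGroup; comm)

  asGroup : Group 0ℓ 0ℓ
  asGroup = record { isGroup = isGroup }
  open GroupProperties asGroup
    using (∙-cancelʳ; ⁻¹-anti-homo-∙; \\-leftDividesʳ; //-rightDividesˡ; //-rightDividesʳ)

  sum-translate : ∀ (f : Fin m → ℤ) a → sum f ≡ sum (λ x → f (x ∙ a))
  sum-translate f a =
    sum-permute f (permutation (_∙ a) (_∙ (⁻ a)) (//-rightDividesˡ a) (//-rightDividesʳ a))

  translate-negated⇒sum-zero : ∀ (f : Fin m → ℤ) a →
    (∀ x → f (x ∙ a) ≡ -1ℤ ℤ.* f x) → sum f ≡ 0ℤ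
  translate-negated⇒sum-zero f a negated = self-negating⇒zero (sum f) (begin
    sum f                           ≡⟨ sum-translate f a ⟩
    sum (λ x → f (x ∙ a))           ≡⟨ sum-cong-≗ negated ⟩
    sum (λ x → -1ℤ ℤ.* f x)         ≡⟨ sym (*-distribˡ-sum -1ℤ f) ⟩
    -1ℤ ℤ.* sum f                   ∎)
    where open ≡-Reasoning

  module Subgroup {E : Subset m} (sg : IsSubgroup G E) where
    closed-∙ : ∀ {x y} → lookup E x ≡ true → lookup E y ≡ true → lookup E (x ∙ y) ≡ true
    closed-∙ {x} {y} x∈E y∈E = VecP.[]=⇒lookup
      (proj₁ (proj₂ sg) x y (VecP.lookup⇒[]= x E x∈E) (VecP.lookup⇒[]= y E y∈E))

    closed-⁻ : ∀ {x} → lookup E x ≡ true → lookup E (⁻ x) ≡ true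
    closed-⁻ {x} x∈E = VecP.[]=⇒lookup (proj₂ (proj₂ sg) x (VecP.lookup⇒[]= x E x∈E))

    -- if x and x ∙ a lie in E, so does a = x⁻¹ ∙ (x ∙ a)
    quotient-closed : ∀ {a x} → lookup E x ≡ true → lookup E (x ∙ a) ≡ true → lookup E a ≡ true
    quotient-closed {a} {x} x∈E xa∈E =
      subst (λ z → lookup E z ≡ true) (\\-leftDividesʳ x a) (closed-∙ (closed-⁻ x∈E) xa∈E)

    translate-in : ∀ {a} x → lookup E a ≡ true → lookup E (x ∙ a) ≡ lookup E x
    translate-in {a} x a∈E = bool-ext
      (λ xa∈E → subst (λ z → lookup E z ≡ true) (//-rightDividesʳ a x) (closed-∙ xa∈E (closed-⁻ a∈E)))
      (λ x∈E → closed-∙ x∈E a∈E)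

  -- The key fact is that translation
  -- by an element outside E swaps E and its complement; it follows by
  -- counting, since E and E ∙ a are disjoint and each has half of G.
  module Index2 {E : Subset m} (index2 : IsIndex2Subgroup G E) where
    open Subgroup (proj₁ index2)

    exactly-one : ∀ {a} → lookup E a ≡ false →
      ∀ x → ind (lookup E (x ∙ a)) ℤ.+ ind (lookup E x) ≡ 1ℤ
    exactly-one {a} a∉E = sum-tight at-most-one total
      where
      at-most-one : ∀ x → ind (lookup E (x ∙ a)) ℤ.+ ind (lookup E x) ℤ.≤ 1ℤ
      at-most-one x with lookup E x in x∈E | lookup E (x ∙ a) in xa∈E
      ... | false | true  = ℤP.≤-refl
      ... | false | false = +≤+ z≤n
      ... | true  | false = ℤP.≤-refl
      ... | true  | true  with trans (sym a∉E) (quotient-closed x∈E xa∈E)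
      ...   | ()
      k = ∣ E ∣
      total : sum (λ x → ind (lookup E (x ∙ a)) ℤ.+ ind (lookup E x)) ≡ sum {m} (λ _ → 1ℤ)
      total = begin
        sum (λ x → ind (lookup E (x ∙ a)) ℤ.+ ind (lookup E x))
          ≡⟨ ∑-distrib-+ (λ x → ind (lookup E (x ∙ a))) (ind ∘ lookup E) ⟩
        sum (λ x → ind (lookup E (x ∙ a))) ℤ.+ sum (ind ∘ lookup E)
          ≡⟨ cong (ℤ._+ sum (ind ∘ lookup E)) (sym (sum-translate (ind ∘ lookup E) a)) ⟩
        sum (ind ∘ lookup E) ℤ.+ sum (ind ∘ lookup E)
          ≡⟨ cong₂ ℤ._+_ (sym (card-sum E)) (sym (card-sum E)) ⟩
        + k ℤ.+ + k
          ≡⟨ sym (ℤP.pos-+ k k) ⟩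
        + (k ℕ.+ k)
          ≡⟨ cong (λ j → + (k ℕ.+ j)) (sym (ℕP.+-identityʳ k)) ⟩
        + (2 * k)
          ≡⟨ cong +_ (sym (proj₂ index2)) ⟩
        + m
          ≡⟨ sym (sum-const-one m) ⟩
        sum {m} (λ _ → 1ℤ) ∎
        where open ≡-Reasoning

    translate-out : ∀ {a} x → lookup E a ≡ false → lookup E (x ∙ a) ≡ not (lookup E x)
    translate-out x a∉E = ind-complementary _ _ (exactly-one a∉E x)

    character-hom : ∀ x a → character E (x ∙ a) ≡ character E x ℤ.* character E a
    character-hom x a with lookup E a in a∈E
    ... | true  = trans (cong sgn (translate-in x a∈E)) (sym (ℤP.*-identityʳ (character E x)))
    ... | false = trans (cong sgn (translate-out x a∈E)) (sgn-not (lookup E x))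

  -- characters of distinct index-2 subgroups are orthogonal: their product
  -- is negated by translation by any element where the subgroups differ
  orthogonal : ∀ {E F} → IsIndex2Subgroup G E → IsIndex2Subgroup G F → E ≢ F →
    sum (λ x → character E x ℤ.* character F x) ≡ 0ℤ
  orthogonal {E} {F} hE hF E≢F with distinct⇒differ E F E≢F
  ... | a , differ = translate-negated⇒sum-zero _ a negated
    where
    χE = character E
    χF = character F
    negated : ∀ x → χE (x ∙ a) ℤ.* χF (x ∙ a) ≡ -1ℤ ℤ.* (χE x ℤ.* χF x)
    negated x = begin
      χE (x ∙ a) ℤ.* χF (x ∙ a)               ≡⟨ cong₂ ℤ._*_ (Index2.character-hom hE x a) (Index2.character-hom hF x a) ⟩
      (χE x ℤ.* χE a) ℤ.* (χF x ℤ.* χF a)     ≡⟨ interchange (χE x) (χE a) (χF x) (χF a) ⟩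
      (χE x ℤ.* χF x) ℤ.* (χE a ℤ.* χF a)     ≡⟨ cong ((χE x ℤ.* χF x) ℤ.*_) (sgn-differ differ) ⟩
      (χE x ℤ.* χF x) ℤ.* -1ℤ                 ≡⟨ ℤP.*-comm _ -1ℤ ⟩
      -1ℤ ℤ.* (χE x ℤ.* χF x)                 ∎
      where open ≡-Reasoning

  S : Subset m
  S = selfInv G

  selfInv-lookup : ∀ y → lookup S y ≡ does (y ≟ (⁻ y))
  selfInv-lookup = VecP.lookup∘tabulate (λ x → does (x ≟ (⁻ x)))

  selfInv-translate : ∀ {s} x → lookup S s ≡ true → lookup S (x ∙ s) ≡ lookup S x
  selfInv-translate {s} x s∈S = begin
    lookup S (x ∙ s)                   ≡⟨ selfInv-lookup (x ∙ s) ⟩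
    does ((x ∙ s) ≟ (⁻ (x ∙ s)))       ≡⟨ does-⇔ (mk⇔ cancel extend) ((x ∙ s) ≟ (⁻ (x ∙ s))) (x ≟ (⁻ x)) ⟩
    does (x ≟ (⁻ x))                   ≡⟨ sym (selfInv-lookup x) ⟩
    lookup S x                         ∎
    where
    open ≡-Reasoning
    s≡⁻s : s ≡ ⁻ s
    s≡⁻s = does-true (s ≟ (⁻ s)) (trans (sym (selfInv-lookup s)) s∈S)
    neg-translate : ⁻ (x ∙ s) ≡ (⁻ x) ∙ s
    neg-translate = trans (⁻¹-anti-homo-∙ x s) (trans (comm (⁻ s) (⁻ x)) (cong ((⁻ x) ∙_) (sym s≡⁻s)))
    cancel : x ∙ s ≡ ⁻ (x ∙ s) → x ≡ ⁻ x
    cancel p = ∙-cancelʳ s x (⁻ x) (trans p neg-translate)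
    extend : x ≡ ⁻ x → x ∙ s ≡ ⁻ (x ∙ s)
    extend p = trans (cong (_∙ s) p) (sym neg-translate)

  r-sum : ∀ X → + r G X ≡ sum (λ y → ind (lookup X y ∧ lookup S y))
  r-sum X = trans (card-sum (X ∩ S)) (sum-cong-≗ (λ y → cong ind (VecP.lookup-zipWith _∧_ y X S)))

  -- a self-inverse element s outside E swaps E and O by translation while
  -- preserving self-inverseness, so r(O) = r(E)
  selfInv-outside⇒balanced : ∀ {E} → IsIndex2Subgroup G E →
    ∀ {s} → lookup S s ≡ true → lookup E s ≡ false → r G (∁ E) ≡ r G E
  selfInv-outside⇒balanced {E} index2 {s} s∈S s∉E = ℤP.+-injective (begin
    + r G (∁ E)                                          ≡⟨ r-sum (∁ E) ⟩
    sum (λ y → ind (lookup (∁ E) y ∧ lookup S y))        ≡⟨ sum-translate _ s ⟩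
    sum (λ y → ind (lookup (∁ E) (y ∙ s) ∧ lookup S (y ∙ s))) ≡⟨ sum-cong-≗ (cong ind ∘ swapped) ⟩
    sum (λ y → ind (lookup E y ∧ lookup S y))            ≡⟨ sym (r-sum E) ⟩
    + r G E                                              ∎)
    where
    open ≡-Reasoning
    swapped : ∀ y → lookup (∁ E) (y ∙ s) ∧ lookup S (y ∙ s) ≡ lookup E y ∧ lookup S y
    swapped y = cong₂ _∧_
      (trans (VecP.lookup-map (y ∙ s) not E)
        (trans (cong not (Index2.translate-out index2 y s∉E)) (not-involutive _)))
      (selfInv-translate y s∈S)

  ContainsSelfInv : Subset m → Set
  ContainsSelfInv E = ∀ s → lookup S s ≡ true → lookup E s ≡ true

  unbalanced⇒containsSelfInv : ∀ {E} → IsIndex2Subgroup G E → r G (∁ E) ≢ r G E → ContainsSelfInv E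
  unbalanced⇒containsSelfInv {E} index2 unbalanced s s∈S with lookup E s in s∈E
  ... | true  = refl
  ... | false = ⊥-elim (unbalanced (selfInv-outside⇒balanced index2 s∈S s∈E))

  orthogonal-sum : ∀ {E Es} → IsIndex2Subgroup G E → All (IsIndex2Subgroup G) Es → All (E ≢_) Es →
    sum (λ x → character E x ℤ.* characterSum Es x) ≡ 0ℤ
  orthogonal-sum {E} {[]} hE [] [] =
    trans (sum-cong-≗ (λ x → ℤP.*-zeroʳ (character E x))) (sum-replicate-zero m)
  orthogonal-sum {E} {F ∷ Es} hE (hF ∷ hEs) (E≢F ∷ E∉Es) = begin
    sum (λ x → χE x ℤ.* (character F x ℤ.+ characterSum Es x))
      ≡⟨ sum-cong-≗ (λ x → ℤP.*-distribˡ-+ (χE x) (character F x) (characterSum Es x)) ⟩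
    sum (λ x → χE x ℤ.* character F x ℤ.+ χE x ℤ.* characterSum Es x)
      ≡⟨ ∑-distrib-+ (λ x → χE x ℤ.* character F x) (λ x → χE x ℤ.* characterSum Es x) ⟩
    sum (λ x → χE x ℤ.* character F x) ℤ.+ sum (λ x → χE x ℤ.* characterSum Es x)
      ≡⟨ cong₂ ℤ._+_ (orthogonal hE hF E≢F) (orthogonal-sum hE hEs E∉Es) ⟩
    0ℤ ∎
    where
    open ≡-Reasoning
    χE = character E

  second-moment : ∀ {Es} → All (IsIndex2Subgroup G) Es → Unique Es →
    sum (λ x → characterSum Es x ℤ.* characterSum Es x) ≡ + (length Es * m)
  second-moment {[]} [] [] = sum-replicate-zero m
  second-moment {E ∷ Es} (hE ∷ hEs) (E∉Es ∷ unique) = begin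
    sum (λ x → (a x ℤ.+ g x) ℤ.* (a x ℤ.+ g x))
      ≡⟨ sum-cong-≗ (λ x → square-expand (a x) (g x)) ⟩
    sum (λ x → (a x ℤ.* a x ℤ.+ g x ℤ.* g x) ℤ.+ (a x ℤ.* g x ℤ.+ a x ℤ.* g x))
      ≡⟨ ∑-distrib-+ (λ x → a x ℤ.* a x ℤ.+ g x ℤ.* g x) (λ x → a x ℤ.* g x ℤ.+ a x ℤ.* g x) ⟩
    sum (λ x → a x ℤ.* a x ℤ.+ g x ℤ.* g x) ℤ.+ sum (λ x → a x ℤ.* g x ℤ.+ a x ℤ.* g x)
      ≡⟨ cong₂ ℤ._+_ (∑-distrib-+ (λ x → a x ℤ.* a x) (λ x → g x ℤ.* g x))
                     (∑-distrib-+ (λ x → a x ℤ.* g x) (λ x → a x ℤ.* g x)) ⟩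
    (sum (λ x → a x ℤ.* a x) ℤ.+ sum (λ x → g x ℤ.* g x)) ℤ.+
      (sum (λ x → a x ℤ.* g x) ℤ.+ sum (λ x → a x ℤ.* g x))
      ≡⟨ cong₂ (λ u v → u ℤ.+ (v ℤ.+ v))
           (cong₂ ℤ._+_ (trans (sum-cong-≗ (sgn-square ∘ lookup E)) (sum-const-one m))
                        (second-moment hEs unique))
           (orthogonal-sum hE hEs E∉Es) ⟩
    (+ m ℤ.+ + (length Es * m)) ℤ.+ 0ℤ
      ≡⟨ ℤP.+-identityʳ _ ⟩
    + m ℤ.+ + (length Es * m)
      ≡⟨ sym (ℤP.pos-+ m (length Es * m)) ⟩
    + (length (E ∷ Es) * m) ∎
    where
    open ≡-Reasoning
    a g : Fin m → ℤ
    a = character E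
    g = characterSum Es

  full : Subset m
  full = tabulate (λ _ → true)

  r-full : + r G full ≡ sum (ind ∘ lookup S)
  r-full = trans (r-sum full) (sum-cong-≗ (λ y → cong (λ b → ind (b ∧ lookup S y)) (VecP.lookup∘tabulate (λ _ → true) y)))

  characterSum-on-selfInv : ∀ {Es} → All ContainsSelfInv Es →
    ∀ x → lookup S x ≡ true → characterSum Es x ≡ + length Es
  characterSum-on-selfInv [] x x∈S = refl
  characterSum-on-selfInv (E⊇S ∷ Es⊇S) x x∈S
    rewrite E⊇S x x∈S | characterSum-on-selfInv Es⊇S x x∈S = refl

  second-moment-lower : ∀ {Es} → All ContainsSelfInv Es →
    + (length Es * length Es) ℤ.* + r G full ℤ.≤ sum (λ x → characterSum Es x ℤ.* characterSum Es x)
  second-moment-lower {Es} Es⊇S = subst (ℤ._≤ _) scaled (sum-mono pointwise)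
    where
    L = length Es
    pointwise : ∀ x → + (L * L) ℤ.* ind (lookup S x) ℤ.≤ characterSum Es x ℤ.* characterSum Es x
    pointwise x with lookup S x in x∈S
    ... | false = subst (ℤ._≤ characterSum Es x ℤ.* characterSum Es x) (sym (ℤP.*-zeroʳ (+ (L * L)))) (square-nonNeg (characterSum Es x))
    ... | true rewrite characterSum-on-selfInv Es⊇S x x∈S =
      ℤP.≤-reflexive (trans (ℤP.*-identityʳ (+ (L * L))) (ℤP.pos-* L L))
    scaled : sum (λ x → + (L * L) ℤ.* ind (lookup S x)) ≡ + (L * L) ℤ.* + r G full
    scaled = trans (sym (*-distribˡ-sum (+ (L * L)) (ind ∘ lookup S))) (cong (+ (L * L) ℤ.*_) (sym r-full))

  count-bound : ∀ {Es} → Unique Es → All (λ E → IsIndex2Subgroup G E × ContainsSelfInv E) Es →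
    length Es * r G full ℕ.≤ m
  count-bound {[]} _ _ = z≤n
  count-bound {Es@(_ ∷ _)} unique hyps = ℕP.*-cancelˡ-≤ L (begin
    L * (L * r G full)   ≡⟨ ℕP.*-assoc L L (r G full) ⟨
    L * L * r G full     ≤⟨ ℤP.drop‿+≤+ moment-bound ⟩
    L * m                ∎)
    where
    open ℕP.≤-Reasoning
    L = length Es
    moment-bound : + (L * L * r G full) ℤ.≤ + (L * m)
    moment-bound = subst₂ ℤ._≤_ (sym (ℤP.pos-* (L * L) (r G full)))
      (second-moment (All.map proj₁ hyps) unique) (second-moment-lower (All.map proj₂ hyps))

ℕ→ℚ-mkℚ : ∀ k → ℕ→ℚ k ≡ ℚ.mkℚ (+ k) 0 (Coprime.sym (Coprime.1-coprimeTo k))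
ℕ→ℚ-mkℚ k = ℚP.normalize-coprime (Coprime.sym (Coprime.1-coprimeTo k))

ℕ→ℚ-* : ∀ a b → ℕ→ℚ (a * b) ≡ ℕ→ℚ a ℚ.* ℕ→ℚ b
ℕ→ℚ-* a b = trans (cong (_/ 1) (ℤP.pos-* a b)) (sym (cong₂ ℚ._*_ (ℕ→ℚ-mkℚ a) (ℕ→ℚ-mkℚ b)))

ℕ→ℚ-mono : ∀ {a b} → a ℕ.≤ b → ℕ→ℚ a ℚ.≤ ℕ→ℚ b
ℕ→ℚ-mono {a} {b} a≤b rewrite ℕ→ℚ-mkℚ a | ℕ→ℚ-mkℚ b = ℚ.*≤* (ℤP.*-monoʳ-≤-nonNeg (+ 1) (+≤+ a≤b))

ratio-bound : ∀ (δ : ℚ) n s L → δ ℚ.* ℕ→ℚ n ℚ.< ℕ→ℚ s → suc L * s ℕ.≤ 2 * n →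
  ℕ→ℚ (suc L) ℚ.* δ ℚ.≤ (+ 2) / 1
ratio-bound δ n s L δn<s Ls≤2n = ℚP.<⇒≤ (ℚP.*-cancelʳ-<-nonNeg (ℕ→ℚ n) {{ℚP.normalize-nonNeg n 1}} (begin-strict
  (ℕ→ℚ (suc L) ℚ.* δ) ℚ.* ℕ→ℚ n   ≡⟨ ℚP.*-assoc (ℕ→ℚ (suc L)) δ (ℕ→ℚ n) ⟩
  ℕ→ℚ (suc L) ℚ.* (δ ℚ.* ℕ→ℚ n)   <⟨ ℚP.*-monoʳ-<-pos (ℕ→ℚ (suc L)) {{ℚP.normalize-pos (suc L) 1}} δn<s ⟩
  ℕ→ℚ (suc L) ℚ.* ℕ→ℚ s           ≡⟨ ℕ→ℚ-* (suc L) s ⟨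
  ℕ→ℚ (suc L * s)                 ≤⟨ ℕ→ℚ-mono Ls≤2n ⟩
  ℕ→ℚ (2 * n)                     ≡⟨ ℕ→ℚ-* 2 n ⟩
  ((+ 2) / 1) ℚ.* ℕ→ℚ n           ∎))
  where open ℚP.≤-Reasoning

lemma3p6 : (δ : ℚ) → 0ℚ ℚ.< δ → (n : ℕ) → (G : FinAbGroup (2 * n))
    → (Es : List (Subset (2 * n))) → Unique Es
    → All (λ E → IsIndex2Subgroup G E × ¬ Nice n G δ E) Es
    → ℕ→ℚ (length Es) ℚ.* δ ℚ.≤ (+ 2) / 1
lemma3p6 δ _ n G [] _ _ = subst (ℚ._≤ (+ 2) / 1) (sym (ℚP.*-zeroˡ δ)) (ℚ.*≤* (+≤+ z≤n))
lemma3p6 δ _ n G (E ∷ Es) unique nonNice@((_ , E-nonNice) ∷ _) =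
  ratio-bound δ n (r G (full G)) (length Es) δn<r (count-bound G unique (All.map containing nonNice))
  where
  δn<r : δ ℚ.* ℕ→ℚ n ℚ.< ℕ→ℚ (r G (full G))
  δn<r = ℚP.≰⇒> (E-nonNice ∘ inj₁)
  containing : ∀ {F} → IsIndex2Subgroup G F × ¬ Nice n G δ F → IsIndex2Subgroup G F × ContainsSelfInv G F
  containing (index2 , F-nonNice) = index2 , unbalanced⇒containsSelfInv G index2 (F-nonNice ∘ inj₂)
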